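{- Let $\ell\ge1$, $V=\{0,1\}^{\ell^2}$, and let $\varphi$ be the modified CFLS coloring of the complete graph on $V$ defined in the context. There do not exist distinct $a,b,c,d,e\in V$ and colors $\alpha,\beta,\gamma,\pi$ with $\varphi(ab)=\varphi(cd)=\alpha$, $\varphi(bc)=\varphi(ad)=\beta$, $\varphi(ae)=\varphi(ac)=\gamma$ and $\varphi(bd)=\varphi(ce)=\pi$.
   Context: Let $\ell$ be a positive integer and $V=\{0,1\}^{\ell^2}$. For $v\in V$ write $v=(v^{(1)},\dots,v^{(\ell)})$ with each block $v^{(k)}\in\{0,1\}^{\ell}$. For distinct $x,y\in V$ let $\varphi_1(x,y)=\big((i,\{x^{(i)},y^{(i)}\}),i_1,\dots,i_\ell\big)$, where $i$ is the least index with $x^{(i)}\ne y^{(i)}$, and $i_k=0$ if $x^{(k)}=y^{(k)}$, otherwise $i_k$ is the least position at which the bits of $x^{(k)}$ and $y^{(k)}$ differ. Order $V$ and $\{0,1\}^\ell$ by reading strings as binary integers (first bit most significant). For $x<y$ let $\varphi_2(x,y)=\varphi_2(y,x)=(\delta_1,\dots,\delta_\ell)$ with $\delta_k=-1$ if $x^{(k)}>y^{(k)}$ and $\delta_k=+1$ if $x^{(k)}\le y^{(k)}$. The modified CFLS coloring is $\varphi(xy)=(\varphi_1(x,y),\varphi_2(x,y))$. -}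

module Defs where

open import Data.Bool using (Bool; true; false; if_then_else_)
open import Data.Bool.Properties using () renaming (_≟_ to _≟B_)
open import Data.Nat using (ℕ; zero; suc; _+_; _*_; _^_; _<ᵇ_)
open import Data.Fin using (Fin; toℕ) renaming (zero to fzero; suc to fsuc)
open import Data.Maybe using (Maybe; just; nothing)
open import Data.Product using (_×_; _,_)
open import Data.Sign using (Sign)
open import Data.Vec using (Vec; []; _∷_; concat; map; zipWith)
open import Data.Vec.Properties using (≡-dec)
open import Relation.Nullary using (yes; no)
open import Relation.Binary.PropositionalEquality using (_≡_)

Bits : ℕ → Set
Bits n = Vec Bool n

-- Vertex set V = {0,1}^(ℓ²), written as ℓ consecutive blocks of ℓ bits each.
V : ℕ → Set
V ℓ = Vec (Bits ℓ) ℓ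

val : ∀ {n} → Bits n → ℕ
val {zero}  []       = 0
val {suc n} (b ∷ bs) = (if b then 2 ^ n else 0) + val bs

_<bits_ : ∀ {n} → Bits n → Bits n → Bool
x <bits y = val x <ᵇ val y

_<V_ : ∀ {ℓ} → V ℓ → V ℓ → Bool
x <V y = concat x <bits concat y

firstDiff : ∀ {A : Set} {n} → (∀ (a b : A) → Bool) → Vec A n → Vec A n → Maybe (Fin n)
firstDiff eq [] [] = nothing
firstDiff eq (a ∷ as) (b ∷ bs) with eq a b
... | true  = Data.Maybe.map fsuc (firstDiff eq as bs)
... | false = just fzero

eqBool : Bool → Bool → Bool
eqBool a b with a ≟B b
... | yes _ = true
... | no _  = false

eqBits : ∀ {n} → Bits n → Bits n → Bool
eqBits x y with ≡-dec _≟B_ x y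
... | yes _ = true
... | no _  = false

-- i_k : 0 if the blocks are equal, otherwise the least (1-based) position where they differ.
blockIndex : ∀ {n} → Bits n → Bits n → ℕ
blockIndex x y with firstDiff eqBool x y
... | nothing = 0
... | just j  = suc (toℕ j)

-- Unordered pair {u , w} of bit strings, represented canonically as (smaller , larger)
-- with respect to the binary order.
UPair : ℕ → Set
UPair n = Bits n × Bits n

upair : ∀ {n} → Bits n → Bits n → UPair n
upair u w = if w <bits u then (w , u) else (u , w)

blockAt : ∀ {ℓ} → V ℓ → Maybe (Fin ℓ) → Maybe (Bits ℓ)
blockAt x nothing  = nothing
blockAt x (just i) = just (Data.Vec.lookup x i)

-- Colour φ₁ : ((i , {x^(i), y^(i)}) , i_1 , … , i_ℓ).
-- For distinct x, y, the index i is  just (least differing block)  and the pair is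
-- just {x^(i), y^(i)}.
Color₁ : ℕ → Set
Color₁ ℓ = (Maybe (Fin ℓ) × Maybe (UPair ℓ)) × Vec ℕ ℓ

φ₁ : ∀ {ℓ} → V ℓ → V ℓ → Color₁ ℓ
φ₁ x y = (i , pairAt i) , zipWith blockIndex x y
  where
  i = firstDiff eqBits x y
  pairAt : Maybe (Fin _) → Maybe (UPair _)
  pairAt nothing  = nothing
  pairAt (just j) = just (upair (Data.Vec.lookup x j) (Data.Vec.lookup y j))

δ : ∀ {ℓ} → V ℓ → V ℓ → Vec Sign ℓ
δ x y = zipWith (λ u w → if w <bits u then Sign.- else Sign.+) x y

φ₂ : ∀ {ℓ} → V ℓ → V ℓ → Vec Sign ℓ
φ₂ x y = if x <V y then δ x y else δ y x

Color : ℕ → Set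
Color ℓ = Color₁ ℓ × Vec Sign ℓ

φ : ∀ {ℓ} → V ℓ → V ℓ → Color ℓ
φ x y = φ₁ x y , φ₂ x y

-- Let r be the first block in which c and e differ. The first component of
-- φ(bd) = φ(ce) forces {b^(r), d^(r)} = {c^(r), e^(r)}. The within-block index i_r
-- vanishes exactly on equal blocks, so in either matching of the pairs the
-- equalities φ(ab) = φ(cd), φ(bc) = φ(ad) give a^(r) = e^(r), and then
-- φ(ae) = φ(ac) gives a^(r) = c^(r), contradicting c^(r) ≠ e^(r).
module Submission where

open import Defs
open import Data.Bool using (Bool; true; false)
open import Data.Bool.Properties using () renaming (_≟_ to _≟B_)
open import Data.Empty using (⊥; ⊥-elim)
open import Function using (_∘_)
open import Data.Fin using (Fin)
open import Data.Maybe using (just; nothing)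
open import Data.Maybe.Properties using (just-injective)
open import Data.Nat using (ℕ; _≥_)
open import Data.Product using (Σ; ∃-syntax; _×_; _,_; proj₁; proj₂)
open import Data.Sum using (_⊎_; inj₁; inj₂)
open import Data.Vec using (Vec; []; _∷_; lookup; zipWith)
open import Data.Vec.Properties using (≡-dec; lookup-zipWith)
open import Relation.Binary.PropositionalEquality
  using (_≡_; _≢_; refl; sym; trans; cong; cong₂; module ≡-Reasoning)
open import Relation.Nullary using (¬_; yes; no)

module _ {A : Set} (eq : A → A → Bool) where

  firstDiff-nothing⇒≡ : (∀ a b → eq a b ≡ true → a ≡ b) →
    ∀ {n} (xs ys : Vec A n) → firstDiff eq xs ys ≡ nothing → xs ≡ ys
  firstDiff-nothing⇒≡ sound [] [] _ = refl
  firstDiff-nothing⇒≡ sound (x ∷ xs) (y ∷ ys) h with eq x y in eq-xy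
  firstDiff-nothing⇒≡ sound (x ∷ xs) (y ∷ ys) h | true with firstDiff eq xs ys in tail
  ... | nothing = cong₂ _∷_ (sound x y eq-xy) (firstDiff-nothing⇒≡ sound xs ys tail)

  firstDiff-≢⇒just : (∀ a b → eq a b ≡ true → a ≡ b) →
    ∀ {n} (xs ys : Vec A n) → xs ≢ ys → ∃[ j ] firstDiff eq xs ys ≡ just j
  firstDiff-≢⇒just sound xs ys xs≢ys with firstDiff eq xs ys in fd
  ... | just j  = j , refl
  ... | nothing = ⊥-elim (xs≢ys (firstDiff-nothing⇒≡ sound xs ys fd))

  firstDiff-just⇒differ : ∀ {n} (xs ys : Vec A n) {j : Fin n} →
    firstDiff eq xs ys ≡ just j → eq (lookup xs j) (lookup ys j) ≡ false
  firstDiff-just⇒differ (x ∷ xs) (y ∷ ys) h with eq x y in eq-xy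
  firstDiff-just⇒differ (x ∷ xs) (y ∷ ys) refl | false = eq-xy
  firstDiff-just⇒differ (x ∷ xs) (y ∷ ys) h | true with firstDiff eq xs ys in tail
  firstDiff-just⇒differ (x ∷ xs) (y ∷ ys) refl | true | just k = firstDiff-just⇒differ xs ys tail

  firstDiff-refl : (∀ a → eq a a ≡ true) → ∀ {n} (xs : Vec A n) → firstDiff eq xs xs ≡ nothing
  firstDiff-refl refl-eq [] = refl
  firstDiff-refl refl-eq (x ∷ xs) rewrite refl-eq x | firstDiff-refl refl-eq xs = refl

eqBool-true⇒≡ : ∀ a b → eqBool a b ≡ true → a ≡ b
eqBool-true⇒≡ true  true  _ = refl
eqBool-true⇒≡ false false _ = refl

eqBool-refl : ∀ a → eqBool a a ≡ true
eqBool-refl true  = refl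
eqBool-refl false = refl

eqBits-true⇒≡ : ∀ {n} (x y : Bits n) → eqBits x y ≡ true → x ≡ y
eqBits-true⇒≡ x y h with ≡-dec _≟B_ x y
... | yes x≡y = x≡y

eqBits-false⇒≢ : ∀ {n} (x y : Bits n) → eqBits x y ≡ false → x ≢ y
eqBits-false⇒≢ x y h with ≡-dec _≟B_ x y
... | no x≢y = x≢y

blockIndex≡0⇒≡ : ∀ {n} (x y : Bits n) → blockIndex x y ≡ 0 → x ≡ y
blockIndex≡0⇒≡ x y h with firstDiff eqBool x y in fd
... | nothing = firstDiff-nothing⇒≡ eqBool eqBool-true⇒≡ x y fd

blockIndex-refl : ∀ {n} (x : Bits n) → blockIndex x x ≡ 0
blockIndex-refl x rewrite firstDiff-refl eqBool eqBool-refl x = refl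

upair-inv : ∀ {n} {u w u′ w′ : Bits n} → upair u w ≡ upair u′ w′ →
  (u ≡ u′ × w ≡ w′) ⊎ (u ≡ w′ × w ≡ u′)
upair-inv {u = u} {w} {u′} {w′} h with w <bits u | w′ <bits u′
upair-inv refl | true  | true  = inj₁ (refl , refl)
upair-inv refl | true  | false = inj₂ (refl , refl)
upair-inv refl | false | true  = inj₂ (refl , refl)
upair-inv refl | false | false = inj₁ (refl , refl)

φ-blockIndex : ∀ {ℓ} {x y z w : V ℓ} → φ x y ≡ φ z w → ∀ r →
  blockIndex (lookup x r) (lookup y r) ≡ blockIndex (lookup z r) (lookup w r)
φ-blockIndex {x = x} {y} {z} {w} h r = begin
  blockIndex (lookup x r) (lookup y r)  ≡⟨ lookup-zipWith blockIndex r x y ⟨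
  lookup (zipWith blockIndex x y) r     ≡⟨ cong (λ col → lookup (proj₂ (proj₁ col)) r) h ⟩
  lookup (zipWith blockIndex z w) r     ≡⟨ lookup-zipWith blockIndex r z w ⟩
  blockIndex (lookup z r) (lookup w r)  ∎
  where open ≡-Reasoning

φ-pair : ∀ {ℓ} {x y z w : V ℓ} {r : Fin ℓ} → φ x y ≡ φ z w →
  firstDiff eqBits z w ≡ just r →
  upair (lookup x r) (lookup y r) ≡ upair (lookup z r) (lookup w r)
φ-pair {x = x} {y} {z} {w} h fd with firstDiff eqBits x y | firstDiff eqBits z w
... | nothing | just _ with () ← cong (proj₁ ∘ proj₁ ∘ proj₁) h
φ-pair h refl | just _ | just _ with refl ← cong (proj₁ ∘ proj₁ ∘ proj₁) h =
  just-injective (cong (proj₂ ∘ proj₁ ∘ proj₁) h)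

≡-from-blockIndex : ∀ {n} (x c e : Bits n) → x ≡ e → blockIndex x e ≡ blockIndex x c → c ≡ e
≡-from-blockIndex x c .x refl xx≡xc = sym (blockIndex≡0⇒≡ x c (trans (sym xx≡xc) (blockIndex-refl x)))

blocks-no-pattern : ∀ {n} (x b c d e : Bits n) → c ≢ e →
  blockIndex x b ≡ blockIndex c d → blockIndex b c ≡ blockIndex x d →
  blockIndex x e ≡ blockIndex x c → upair b d ≡ upair c e → ⊥
blocks-no-pattern x b c d e c≢e xb≡cd bc≡xd xe≡xc bd≡ce with upair-inv bd≡ce
... | inj₁ (refl , refl) =
  c≢e (≡-from-blockIndex x c e (blockIndex≡0⇒≡ x e (trans (sym bc≡xd) (blockIndex-refl c))) xe≡xc)
... | inj₂ (refl , refl) =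
  c≢e (≡-from-blockIndex x c e (blockIndex≡0⇒≡ x e (trans xb≡cd (blockIndex-refl c))) xe≡xc)

lemma9 : (ℓ : ℕ) → ℓ ≥ 1 → (a b c d e : V ℓ) →
    a ≢ b → a ≢ c → a ≢ d → a ≢ e → b ≢ c → b ≢ d → b ≢ e → c ≢ d → c ≢ e → d ≢ e →
    ¬ (Σ (Color ℓ) λ α → Σ (Color ℓ) λ β → Σ (Color ℓ) λ γ → Σ (Color ℓ) λ π →
         (φ a b ≡ α × φ c d ≡ α) × (φ b c ≡ β × φ a d ≡ β) ×
         (φ a e ≡ γ × φ a c ≡ γ) × (φ b d ≡ π × φ c e ≡ π))
lemma9 ℓ _ a b c d e _ _ _ _ _ _ _ _ c≢e _
  (_ , _ , _ , _ , (ab , cd) , (bc , ad) , (ae , ac) , (bd , ce))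
  with (r , first-ce) ← firstDiff-≢⇒just eqBits eqBits-true⇒≡ c e c≢e =
  blocks-no-pattern (lookup a r) (lookup b r) (lookup c r) (lookup d r) (lookup e r)
    (eqBits-false⇒≢ _ _ (firstDiff-just⇒differ eqBits c e first-ce))
    (φ-blockIndex (trans ab (sym cd)) r)
    (φ-blockIndex (trans bc (sym ad)) r)
    (φ-blockIndex (trans ae (sym ac)) r)
    (φ-pair (trans bd (sym ce)) first-ce)
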